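{- Let $G$ be a graph with no isolated vertices, let $uv\in E(\overline{G})$ satisfy $\gamma_{tR}(G+uv)<\gamma_{tR}(G)$, and let $f$ be a TRD-function on $G+uv$ of weight $\gamma_{tR}(G+uv)$. Then $\{f(u),f(v)\}\in\{\{2,2\},\{2,1\},\{2,0\},\{1,1\}\}$ (as multisets). If in addition $\deg_G(u)=\deg_G(v)=1$, then there exists a TRD-function $f$ on $G+uv$ of weight $\gamma_{tR}(G+uv)$ with $f(u)=f(v)=1$.
   Context: All graphs are finite and simple. For a graph $G$ with no isolated vertices, a total Roman dominating function (TRD-function) is a map $f:V(G)\to\{0,1,2\}$ such that every vertex with $f(v)=0$ is adjacent to a vertex $u$ with $f(u)=2$, and the subgraph induced by $\{v:f(v)>0\}$ has no isolated vertices; its weight is $\sum_v f(v)$, and $\gamma_{tR}(G)$ is the minimum weight of a TRD-function on $G$. -}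

module Defs where

open import Data.Nat using (ℕ; zero; suc; _+_; _≤_; _<_)
open import Data.Fin using (Fin; _≟_)
open import Data.Bool using (Bool; true; false; _∨_; _∧_; if_then_else_)
open import Data.List using (List; map; allFin)
open import Data.Nat.ListAction using (sum)
open import Data.Product using (Σ; _×_; ∃; ∃-syntax; _,_)
open import Data.Sum using (_⊎_)
open import Relation.Nullary.Decidable using (⌊_⌋)
open import Relation.Binary.PropositionalEquality using (_≡_)

Adjacency : ℕ → Set
Adjacency n = Fin n → Fin n → Bool

record IsSimple {n : ℕ} (adj : Adjacency n) : Set where
  field
    symmetric   : ∀ x y → adj x y ≡ adj y x
    irreflexive : ∀ x → adj x x ≡ false

NoIsolated : ∀ {n} → Adjacency n → Set
NoIsolated {n} adj = ∀ (x : Fin n) → ∃[ y ] adj x y ≡ true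

addEdge : ∀ {n} → Adjacency n → Fin n → Fin n → Adjacency n
addEdge adj u v x y =
  adj x y ∨ ((⌊ x ≟ u ⌋ ∧ ⌊ y ≟ v ⌋) ∨ (⌊ x ≟ v ⌋ ∧ ⌊ y ≟ u ⌋))

deg : ∀ {n} → Adjacency n → Fin n → ℕ
deg {n} adj x = sum (map (λ y → if adj x y then 1 else 0) (allFin n))

weight : ∀ {n} → (Fin n → ℕ) → ℕ
weight {n} f = sum (map f (allFin n))

record IsTRDF {n : ℕ} (adj : Adjacency n) (f : Fin n → ℕ) : Set where
  field
    range    : ∀ x → f x ≤ 2
    zeroDom  : ∀ x → f x ≡ 0 → ∃[ y ] (adj x y ≡ true × f y ≡ 2)
    totalPos : ∀ x → 0 < f x → ∃[ y ] (adj x y ≡ true × 0 < f y)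

IsGammaTR : ∀ {n} → Adjacency n → ℕ → Set
IsGammaTR {n} adj k =
  (∃[ f ] (IsTRDF adj f × weight f ≡ k)) ×
  (∀ (g : Fin n → ℕ) → IsTRDF adj g → k ≤ weight g)

_≈ₘ_ : ℕ × ℕ → ℕ × ℕ → Set
(a , b) ≈ₘ (c , d) = (a ≡ c × b ≡ d) ⊎ (a ≡ d × b ≡ c)

AllowedPair : ℕ → ℕ → Set
AllowedPair a b =
  ((a , b) ≈ₘ (2 , 2)) ⊎ ((a , b) ≈ₘ (2 , 1)) ⊎ ((a , b) ≈ₘ (2 , 0)) ⊎ ((a , b) ≈ₘ (1 , 1))

-- If a minimum TRD-function f of G + uv made no use of the new edge (no 0 at one end dominated
-- by a 2 at the other, and not both ends positive), it would be a TRD-function of G of weight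
-- γ_tR(G + uv) < γ_tR(G); the pairs that do use the edge are exactly the allowed ones.
-- If u and v are leaves of G with neighbours u′ and v′, an end labelled 2 has exactly two
-- neighbours in G + uv, and it can be relabelled 1 while one neighbour is raised to at least 1
-- without losing the TRD property or increasing the weight; at most two such moves give
-- f(u) = f(v) = 1.
module Submission where

open import Defs
open import Data.Nat using (ℕ; _<_)
open import Data.Fin using (Fin)
open import Data.Bool using (false)
open import Data.Product using (_×_; ∃-syntax)
open import Relation.Nullary using (¬_)
open import Relation.Binary.PropositionalEquality using (_≡_)

open import Algebra.Properties.CommutativeSemigroup using (interchange)
open import Data.Bool using (true; if_then_else_; _∨_; _∧_)
open import Data.Bool.Properties using (∨-comm; ∧-comm)
open import Data.Fin as Fin using (_≟_)
open import Data.List.Properties using (map-tabulate)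
open import Data.Nat using (zero; suc; _+_; _⊔_; _≤_; z≤n; s≤s)
open import Data.Nat.ListAction using (sum)
open import Data.Nat.Properties
  using ( +-mono-≤; +-cancelʳ-≤; +-comm; +-identityʳ; +-commutativeSemigroup
        ; ≤-refl; ≤-trans; ≤-antisym; <⇒≱; m⊔n≤m+n; m≤m⊔n; m≤n⊔m; ⊔-lub; m≤n⇒m⊔n≡n
        ; n>0⇒n≢0; n≢0⇒n>0 )
  renaming (_≟_ to _≟ℕ_)
open import Data.Product using (_,_; proj₁; proj₂)
open import Data.Sum using (_⊎_; inj₁; inj₂)
open import Function using (_∘_; id)
open import Relation.Nullary using (yes; no; contradiction)
open import Relation.Nullary.Decidable using (⌊_⌋)
open import Relation.Binary.PropositionalEquality using (refl; sym; trans; cong; cong₂; subst; subst₂)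

weight-suc : ∀ {n} (f : Fin (suc n) → ℕ) → weight f ≡ f Fin.zero + weight (f ∘ Fin.suc)
weight-suc f = cong (λ xs → f Fin.zero + sum xs)
  (trans (map-tabulate Fin.suc f) (sym (map-tabulate id (f ∘ Fin.suc))))

weight-cong : ∀ {n} {f g : Fin n → ℕ} → (∀ x → f x ≡ g x) → weight f ≡ weight g
weight-cong {zero} _ = refl
weight-cong {suc n} {f} {g} f≗g rewrite weight-suc f | weight-suc g =
  cong₂ _+_ (f≗g Fin.zero) (weight-cong (f≗g ∘ Fin.suc))

weight-mono : ∀ {n} {f g : Fin n → ℕ} → (∀ x → f x ≤ g x) → weight f ≤ weight g
weight-mono {zero} _ = z≤n
weight-mono {suc n} {f} {g} f≤g rewrite weight-suc f | weight-suc g =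
  +-mono-≤ (f≤g Fin.zero) (weight-mono (f≤g ∘ Fin.suc))

weight-+ : ∀ {n} (f g : Fin n → ℕ) → weight (λ x → f x + g x) ≡ weight f + weight g
weight-+ {zero} f g = refl
weight-+ {suc n} f g
  rewrite weight-suc (λ x → f x + g x) | weight-suc f | weight-suc g
        | weight-+ (f ∘ Fin.suc) (g ∘ Fin.suc) =
  interchange +-commutativeSemigroup (f Fin.zero) (g Fin.zero) _ _

δ : ∀ {n} → Fin n → ℕ → Fin n → ℕ
δ y c x = if ⌊ x ≟ y ⌋ then c else 0

weight-δ : ∀ {n} (y : Fin n) (c : ℕ) → weight (δ y c) ≡ c
weight-δ {suc n} Fin.zero c =
  trans (weight-suc {n} (δ Fin.zero c))
        (trans (cong (c +_) (weight-0 n)) (+-identityʳ c))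
  where
  weight-0 : ∀ m → weight {m} (λ _ → 0) ≡ 0
  weight-0 zero = refl
  weight-0 (suc m) = trans (weight-suc {m} (λ _ → 0)) (weight-0 m)
weight-δ {suc n} (Fin.suc y) c =
  trans (weight-suc (δ (Fin.suc y) c)) (trans (weight-cong δ-suc) (weight-δ y c))
  where
  δ-suc : ∀ x → δ (Fin.suc y) c (Fin.suc x) ≡ δ y c x
  δ-suc x with x ≟ y
  ... | yes _ = refl
  ... | no _ = refl

deg≡1⇒unique-neighbour : ∀ {n} (adj : Adjacency n) {w y z : Fin n} →
  deg adj w ≡ 1 → adj w y ≡ true → adj w z ≡ true → z ≡ y
deg≡1⇒unique-neighbour adj {w} {y} {z} deg≡1 wy wz with z ≟ y
... | yes z≡y = z≡y
... | no z≢y = contradiction (subst (2 ≤_) deg≡1 two≤deg) λ { (s≤s ()) }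
  where
  indicators≤adjacency : ∀ x → δ y 1 x + δ z 1 x ≤ (if adj w x then 1 else 0)
  indicators≤adjacency x with x ≟ y | x ≟ z
  ... | yes refl | yes refl = contradiction refl z≢y
  ... | yes refl | no _ rewrite wy = ≤-refl
  ... | no _ | yes refl rewrite wz = ≤-refl
  ... | no _ | no _ = z≤n

  two≤deg : 2 ≤ deg adj w
  two≤deg = subst (_≤ deg adj w)
    (trans (weight-+ (δ y 1) (δ z 1)) (cong₂ _+_ (weight-δ y 1) (weight-δ z 1)))
    (weight-mono indicators≤adjacency)

module _ {n} (adj : Adjacency n) (u v : Fin n) where

  addEdge-old : ∀ {x y} → adj x y ≡ true → addEdge adj u v x y ≡ true
  addEdge-old xy rewrite xy = refl

  addEdge-new : addEdge adj u v u v ≡ true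
  addEdge-new with adj u v | u ≟ u | v ≟ v
  ... | true  | _     | _     = refl
  ... | false | yes _ | yes _ = refl
  ... | false | no u≢u | _    = contradiction refl u≢u
  ... | false | _     | no v≢v = contradiction refl v≢v

  addEdge-edge : ∀ x y → addEdge adj u v x y ≡ true →
    adj x y ≡ true ⊎ (x ≡ u × y ≡ v) ⊎ (x ≡ v × y ≡ u)
  addEdge-edge x y e with adj x y | x ≟ u | y ≟ v | x ≟ v | y ≟ u
  ... | true  | _     | _     | _     | _     = inj₁ refl
  ... | false | yes p | yes q | _     | _     = inj₂ (inj₁ (p , q))
  ... | false | _     | _     | yes p | yes q = inj₂ (inj₂ (p , q))
  addEdge-edge x y () | false | no _  | _     | no _  | _
  addEdge-edge x y () | false | yes _ | no _  | no _  | _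
  addEdge-edge x y () | false | no _  | _     | yes _ | no _
  addEdge-edge x y () | false | yes _ | no _  | yes _ | no _

  addEdge-isSimple : IsSimple adj → ¬ u ≡ v → IsSimple (addEdge adj u v)
  addEdge-isSimple simple u≢v = record { symmetric = symmetric′ ; irreflexive = irreflexive′ }
    where
    open IsSimple simple

    symmetric′ : ∀ x y → addEdge adj u v x y ≡ addEdge adj u v y x
    symmetric′ x y = cong₂ _∨_ (symmetric x y)
      (trans (∨-comm (⌊ x ≟ u ⌋ ∧ ⌊ y ≟ v ⌋) _)
             (cong₂ _∨_ (∧-comm ⌊ x ≟ v ⌋ _) (∧-comm ⌊ x ≟ u ⌋ _)))

    irreflexive′ : ∀ x → addEdge adj u v x x ≡ false
    irreflexive′ x rewrite irreflexive x with x ≟ u | x ≟ v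
    ... | yes refl | yes refl = contradiction refl u≢v
    ... | yes _    | no _     = refl
    ... | no _     | yes _    = refl
    ... | no _     | no _     = refl

-- Move a unit from w (labelled 2) to p, which ends up positive.
transfer : ∀ {n} → Fin n → Fin n → (Fin n → ℕ) → Fin n → ℕ
transfer w p f x with x ≟ w | x ≟ p
... | yes _ | _     = 1
... | no _  | yes _ = 1 ⊔ f x
... | no _  | no _  = f x

module Transfer {n} (w p : Fin n) (f : Fin n → ℕ) where

  transfer-source : transfer w p f w ≡ 1
  transfer-source with w ≟ w
  ... | yes _   = refl
  ... | no w≢w = contradiction refl w≢w

  transfer-target : ¬ w ≡ p → transfer w p f p ≡ 1 ⊔ f p
  transfer-target w≢p with p ≟ w | p ≟ p
  ... | yes p≡w | _      = contradiction (sym p≡w) w≢p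
  ... | no _    | yes _  = refl
  ... | no _    | no p≢p = contradiction refl p≢p

  transfer-other : ∀ {x} → ¬ x ≡ w → ¬ x ≡ p → transfer w p f x ≡ f x
  transfer-other {x} x≢w x≢p with x ≟ w | x ≟ p
  ... | yes x≡w | _       = contradiction x≡w x≢w
  ... | no _    | yes x≡p = contradiction x≡p x≢p
  ... | no _    | no _    = refl

  transfer-pos : ∀ {x} → 0 < f x → 0 < transfer w p f x
  transfer-pos {x} fx>0 with x ≟ w | x ≟ p
  ... | yes _ | _     = s≤s z≤n
  ... | no _  | yes _ = ≤-trans fx>0 (m≤n⊔m 1 (f x))
  ... | no _  | no _  = fx>0

  transfer-≤2 : ∀ {x} → f x ≤ 2 → transfer w p f x ≤ 2
  transfer-≤2 {x} fx≤2 with x ≟ w | x ≟ p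
  ... | yes _ | _     = s≤s z≤n
  ... | no _  | yes _ = ⊔-lub (s≤s z≤n) fx≤2
  ... | no _  | no _  = fx≤2

  transfer-two : ∀ {x} → ¬ x ≡ w → f x ≡ 2 → transfer w p f x ≡ 2
  transfer-two {x} x≢w fx≡2 with x ≟ w | x ≟ p
  ... | yes x≡w | _     = contradiction x≡w x≢w
  ... | no _    | yes _ = cong (1 ⊔_) fx≡2
  ... | no _    | no _  = fx≡2

  transfer-zero : ∀ {x} → transfer w p f x ≡ 0 → ¬ x ≡ w × ¬ x ≡ p × f x ≡ 0
  transfer-zero {x} tx≡0 with x ≟ w | x ≟ p
  ... | yes _   | _       = contradiction tx≡0 λ ()
  ... | no _    | yes _   = contradiction (subst (1 ≤_) tx≡0 (m≤m⊔n 1 (f x))) λ ()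
  ... | no x≢w  | no x≢p  = x≢w , x≢p , tx≡0

  transfer-weight : f w ≡ 2 → ¬ w ≡ p → weight (transfer w p f) ≤ weight f
  transfer-weight fw≡2 w≢p = +-cancelʳ-≤ 1 _ _ (subst₂ _≤_
    (trans (weight-+ (transfer w p f) (δ w 1)) (cong (weight (transfer w p f) +_) (weight-δ w 1)))
    (trans (weight-+ f (δ p 1)) (cong (weight f +_) (weight-δ p 1)))
    (weight-mono pointwise))
    where
    pointwise : ∀ x → transfer w p f x + δ w 1 x ≤ f x + δ p 1 x
    pointwise x with x ≟ w | x ≟ p
    ... | yes refl | yes refl = contradiction refl w≢p
    ... | yes refl | no _     = subst (2 ≤_) (sym (trans (+-identityʳ (f x)) fw≡2)) ≤-refl
    ... | no _     | yes _    = subst₂ _≤_ (sym (+-identityʳ _)) (+-comm 1 (f x)) (m⊔n≤m+n 1 (f x))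
    ... | no _     | no _     = ≤-refl

module _ {n} {adj : Adjacency n} (simple : IsSimple adj) where
  open IsSimple simple

  adjacent⇒distinct : ∀ {x y} → adj x y ≡ true → ¬ x ≡ y
  adjacent⇒distinct {x} xy refl = contradiction (trans (sym (irreflexive x)) xy) λ ()

  transfer-isTRDF : ∀ {f w p} → IsTRDF adj f → f w ≡ 2 → adj w p ≡ true →
    (∀ y → adj w y ≡ true → ¬ y ≡ p → 0 < f y) → IsTRDF adj (transfer w p f)
  transfer-isTRDF {f} {w} {p} trdf fw≡2 wp others-pos = record
    { range = λ x → transfer-≤2 (range x) ; zeroDom = zeroDom′ ; totalPos = totalPos′ }
    where
    open IsTRDF trdf
    open Transfer w p f
    g : Fin n → ℕ
    g = transfer w p f

    zeroDom′ : ∀ x → g x ≡ 0 → ∃[ y ] (adj x y ≡ true × g y ≡ 2)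
    zeroDom′ x gx≡0 with transfer-zero gx≡0
    ... | x≢w , x≢p , fx≡0 with zeroDom x fx≡0
    ...   | y , xy , fy≡2 with y ≟ w
    ...     | yes refl = contradiction fx≡0 (n>0⇒n≢0 (others-pos x (trans (symmetric y x) xy) x≢p))
    ...     | no y≢w   = y , xy , transfer-two y≢w fy≡2

    totalPos′ : ∀ x → 0 < g x → ∃[ y ] (adj x y ≡ true × 0 < g y)
    totalPos′ x gx>0 with x ≟ w | x ≟ p
    ... | yes refl | _        = p , wp , subst (0 <_) (sym (transfer-target (adjacent⇒distinct wp))) (m≤m⊔n 1 (f p))
    ... | no _     | yes refl = w , trans (symmetric p w) wp , subst (0 <_) (sym transfer-source) (s≤s z≤n)
    ... | no _     | no _     with totalPos x gx>0
    ...   | y , xy , fy>0 = y , xy , transfer-pos fy>0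

  relabel-degree-two-vertex : ∀ {f w w′ z} → IsTRDF adj f → f w ≡ 2 →
    adj w w′ ≡ true → adj w z ≡ true → ¬ w′ ≡ z →
    (∀ y → adj w y ≡ true → y ≡ w′ ⊎ y ≡ z) →
    ∃[ g ] (IsTRDF adj g × weight g ≤ weight f × g w ≡ 1 × g z ≡ 1 ⊔ f z)
  -- When f z = 0 the positive neighbour of w must be w′, so the unit goes to z; otherwise to w′.
  relabel-degree-two-vertex {f} {w} {w′} {z} trdf fw≡2 ww′ wz w′≢z neighbours
    with f z ≟ℕ 0
  ... | yes fz≡0 =
    transfer w z f ,
    transfer-isTRDF trdf fw≡2 wz (λ y wy y≢z → w′-pos y (neighbours y wy) y≢z) ,
    transfer-weight fw≡2 w≢z , transfer-source , transfer-target w≢z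
    where
    open Transfer w z f
    w≢z : ¬ w ≡ z
    w≢z = adjacent⇒distinct wz
    w′-pos : ∀ y → y ≡ w′ ⊎ y ≡ z → ¬ y ≡ z → 0 < f y
    w′-pos y (inj₂ y≡z) y≢z = contradiction y≡z y≢z
    w′-pos y (inj₁ refl) _ with IsTRDF.totalPos trdf w (subst (0 <_) (sym fw≡2) (s≤s z≤n))
    ... | y′ , wy′ , fy′>0 with neighbours y′ wy′
    ...   | inj₁ refl = fy′>0
    ...   | inj₂ refl = contradiction fz≡0 (n>0⇒n≢0 fy′>0)
  ... | no fz≢0 =
    transfer w w′ f ,
    transfer-isTRDF trdf fw≡2 ww′ (λ y wy y≢w′ → z-pos y (neighbours y wy) y≢w′) ,
    transfer-weight fw≡2 w≢w′ , transfer-source ,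
    trans (transfer-other z≢w (w′≢z ∘ sym)) (sym (m≤n⇒m⊔n≡n (n≢0⇒n>0 fz≢0)))
    where
    open Transfer w w′ f
    w≢w′ : ¬ w ≡ w′
    w≢w′ = adjacent⇒distinct ww′
    z≢w : ¬ z ≡ w
    z≢w = adjacent⇒distinct wz ∘ sym
    z-pos : ∀ y → y ≡ w′ ⊎ y ≡ z → ¬ y ≡ w′ → 0 < f y
    z-pos y (inj₁ y≡w′) y≢w′ = contradiction y≡w′ y≢w′
    z-pos y (inj₂ refl) _ = n≢0⇒n>0 fz≢0

NewEdgeUnneeded : ℕ → ℕ → Set
NewEdgeUnneeded a b = ¬ (a ≡ 0 × b ≡ 2) × ¬ (a ≡ 2 × b ≡ 0) × ¬ (0 < a × 0 < b)

allowed⊎unneeded : ∀ {a b} → a ≤ 2 → b ≤ 2 → AllowedPair a b ⊎ NewEdgeUnneeded a b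
allowed⊎unneeded z≤n             z≤n             = inj₂ ((λ ()) , (λ ()) , λ ())
allowed⊎unneeded z≤n             (s≤s z≤n)       = inj₂ ((λ ()) , (λ ()) , λ ())
allowed⊎unneeded z≤n             (s≤s (s≤s z≤n)) = inj₁ (inj₂ (inj₂ (inj₁ (inj₂ (refl , refl)))))
allowed⊎unneeded (s≤s z≤n)       z≤n             = inj₂ ((λ ()) , (λ ()) , λ ())
allowed⊎unneeded (s≤s z≤n)       (s≤s z≤n)       = inj₁ (inj₂ (inj₂ (inj₂ (inj₁ (refl , refl)))))
allowed⊎unneeded (s≤s z≤n)       (s≤s (s≤s z≤n)) = inj₁ (inj₂ (inj₁ (inj₂ (refl , refl))))
allowed⊎unneeded (s≤s (s≤s z≤n)) z≤n             = inj₁ (inj₂ (inj₂ (inj₁ (inj₁ (refl , refl)))))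
allowed⊎unneeded (s≤s (s≤s z≤n)) (s≤s z≤n)       = inj₁ (inj₂ (inj₁ (inj₁ (refl , refl))))
allowed⊎unneeded (s≤s (s≤s z≤n)) (s≤s (s≤s z≤n)) = inj₁ (inj₁ (inj₁ (refl , refl)))

module _ {n} (adj : Adjacency n) (u v : Fin n) where

  private
    H : Adjacency n
    H = addEdge adj u v

  addEdge-unneeded : ∀ {f} → IsTRDF H f → NewEdgeUnneeded (f u) (f v) → IsTRDF adj f
  addEdge-unneeded {f} trdf (¬0-2 , ¬2-0 , ¬pos-pos) = record
    { range = range ; zeroDom = zeroDom′ ; totalPos = totalPos′ }
    where
    open IsTRDF trdf

    zeroDom′ : ∀ x → f x ≡ 0 → ∃[ y ] (adj x y ≡ true × f y ≡ 2)
    zeroDom′ x fx≡0 with zeroDom x fx≡0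
    ... | y , xy , fy≡2 with addEdge-edge adj u v x y xy
    ...   | inj₁ xy∈G               = y , xy∈G , fy≡2
    ...   | inj₂ (inj₁ (refl , refl)) = contradiction (fx≡0 , fy≡2) ¬0-2
    ...   | inj₂ (inj₂ (refl , refl)) = contradiction (fy≡2 , fx≡0) ¬2-0

    totalPos′ : ∀ x → 0 < f x → ∃[ y ] (adj x y ≡ true × 0 < f y)
    totalPos′ x fx>0 with totalPos x fx>0
    ... | y , xy , fy>0 with addEdge-edge adj u v x y xy
    ...   | inj₁ xy∈G               = y , xy∈G , fy>0
    ...   | inj₂ (inj₁ (refl , refl)) = contradiction (fx>0 , fy>0) ¬pos-pos
    ...   | inj₂ (inj₂ (refl , refl)) = contradiction (fy>0 , fx>0) ¬pos-pos

  minimum-endpoints-allowed : ∀ {k₊ k f} → IsGammaTR adj k → k₊ < k →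
    IsTRDF H f → weight f ≡ k₊ → AllowedPair (f u) (f v)
  minimum-endpoints-allowed {k₊} {k} {f} (_ , k-minimal) k₊<k trdf wf≡k₊
    with allowed⊎unneeded (IsTRDF.range trdf u) (IsTRDF.range trdf v)
  ... | inj₁ allowed  = allowed
  ... | inj₂ unneeded =
    contradiction (subst (k ≤_) wf≡k₊ (k-minimal f (addEdge-unneeded trdf unneeded))) (<⇒≱ k₊<k)

module _ {n} {adj : Adjacency n} (simple : IsSimple adj)
         {u v : Fin n} (u≢v : ¬ u ≡ v) (uv∉G : adj u v ≡ false)
         {u′ v′ : Fin n} (uu′ : adj u u′ ≡ true) (vv′ : adj v v′ ≡ true)
         (u-leaf : ∀ y → adj u y ≡ true → y ≡ u′) (v-leaf : ∀ y → adj v y ≡ true → y ≡ v′)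
         where

  private
    H : Adjacency n
    H = addEdge adj u v

    H-simple : IsSimple H
    H-simple = addEdge-isSimple adj u v simple u≢v

    u-neighbours : ∀ y → H u y ≡ true → y ≡ u′ ⊎ y ≡ v
    u-neighbours y uy with addEdge-edge adj u v u y uy
    ... | inj₁ uy∈G             = inj₁ (u-leaf y uy∈G)
    ... | inj₂ (inj₁ (_ , y≡v)) = inj₂ y≡v
    ... | inj₂ (inj₂ (u≡v , _)) = contradiction u≡v u≢v

    v-neighbours : ∀ y → H v y ≡ true → y ≡ v′ ⊎ y ≡ u
    v-neighbours y vy with addEdge-edge adj u v v y vy
    ... | inj₁ vy∈G             = inj₁ (v-leaf y vy∈G)
    ... | inj₂ (inj₁ (v≡u , _)) = contradiction (sym v≡u) u≢v
    ... | inj₂ (inj₂ (_ , y≡u)) = inj₂ y≡u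

    u′≢v : ¬ u′ ≡ v
    u′≢v refl = contradiction (trans (sym uu′) uv∉G) λ ()

    v′≢u : ¬ v′ ≡ u
    v′≢u refl = contradiction (trans (sym vv′) (trans (IsSimple.symmetric simple v u) uv∉G)) λ ()

  UnitEndpointsBelow : (Fin n → ℕ) → Set
  UnitEndpointsBelow f = ∃[ g ] (IsTRDF H g × weight g ≤ weight f × g u ≡ 1 × g v ≡ 1)

  relabel-u : ∀ {f} → IsTRDF H f → f u ≡ 2 → 1 ⊔ f v ≡ 1 → UnitEndpointsBelow f
  relabel-u trdf fu≡2 1⊔fv≡1
    with relabel-degree-two-vertex H-simple trdf fu≡2
           (addEdge-old adj u v uu′) (addEdge-new adj u v) u′≢v u-neighbours
  ... | g , g-trdf , g≤f , gu≡1 , gv≡1⊔fv = g , g-trdf , g≤f , gu≡1 , trans gv≡1⊔fv 1⊔fv≡1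

  relabel-v : ∀ {f} → IsTRDF H f → f v ≡ 2 → 1 ⊔ f u ≡ 1 → UnitEndpointsBelow f
  relabel-v trdf fv≡2 1⊔fu≡1
    with relabel-degree-two-vertex H-simple trdf fv≡2
           (addEdge-old adj u v vv′) (trans (IsSimple.symmetric H-simple v u) (addEdge-new adj u v))
           v′≢u v-neighbours
  ... | g , g-trdf , g≤f , gv≡1 , gu≡1⊔fu = g , g-trdf , g≤f , trans gu≡1⊔fu 1⊔fu≡1 , gv≡1

  relabel-both : ∀ {f} → IsTRDF H f → f u ≡ 2 → f v ≡ 2 → UnitEndpointsBelow f
  relabel-both trdf fu≡2 fv≡2
    with relabel-degree-two-vertex H-simple trdf fu≡2
           (addEdge-old adj u v uu′) (addEdge-new adj u v) u′≢v u-neighbours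
  ... | g , g-trdf , g≤f , gu≡1 , gv≡1⊔fv
    with relabel-v g-trdf (trans gv≡1⊔fv (cong (1 ⊔_) fv≡2)) (cong (1 ⊔_) gu≡1)
  ...   | h , h-trdf , h≤g , hu≡1 , hv≡1 = h , h-trdf , ≤-trans h≤g g≤f , hu≡1 , hv≡1

  allowed⇒unitEndpointsBelow : ∀ {f} → IsTRDF H f → AllowedPair (f u) (f v) → UnitEndpointsBelow f
  allowed⇒unitEndpointsBelow t (inj₁ (inj₁ (fu≡2 , fv≡2)))         = relabel-both t fu≡2 fv≡2
  allowed⇒unitEndpointsBelow t (inj₁ (inj₂ (fu≡2 , fv≡2)))         = relabel-both t fu≡2 fv≡2
  allowed⇒unitEndpointsBelow t (inj₂ (inj₁ (inj₁ (fu≡2 , fv≡1))))  = relabel-u t fu≡2 (cong (1 ⊔_) fv≡1)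
  allowed⇒unitEndpointsBelow t (inj₂ (inj₁ (inj₂ (fu≡1 , fv≡2))))  = relabel-v t fv≡2 (cong (1 ⊔_) fu≡1)
  allowed⇒unitEndpointsBelow t (inj₂ (inj₂ (inj₁ (inj₁ (fu≡2 , fv≡0))))) = relabel-u t fu≡2 (cong (1 ⊔_) fv≡0)
  allowed⇒unitEndpointsBelow t (inj₂ (inj₂ (inj₁ (inj₂ (fu≡0 , fv≡2))))) = relabel-v t fv≡2 (cong (1 ⊔_) fu≡0)
  allowed⇒unitEndpointsBelow {f} t (inj₂ (inj₂ (inj₂ (inj₁ (fu≡1 , fv≡1))))) = f , t , ≤-refl , fu≡1 , fv≡1
  allowed⇒unitEndpointsBelow {f} t (inj₂ (inj₂ (inj₂ (inj₂ (fu≡1 , fv≡1))))) = f , t , ≤-refl , fu≡1 , fv≡1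

mainTheorem5 : ∀ (n : ℕ) (adj : Adjacency n) → IsSimple adj → NoIsolated adj →
    ∀ (u v : Fin n) → ¬ (u ≡ v) → adj u v ≡ false →
    ∀ (k₊ k : ℕ) → IsGammaTR (addEdge adj u v) k₊ → IsGammaTR adj k → k₊ < k →
    (∀ (f : Fin n → ℕ) → IsTRDF (addEdge adj u v) f → weight f ≡ k₊ → AllowedPair (f u) (f v))
    × (deg adj u ≡ 1 → deg adj v ≡ 1 →
        ∃[ f ] (IsTRDF (addEdge adj u v) f × weight f ≡ k₊ × f u ≡ 1 × f v ≡ 1))
mainTheorem5 n adj simple noIsolated u v u≢v uv∉G k₊ k γ₊ γ k₊<k = allowed , unit-endpoints
  where
  allowed : ∀ f → IsTRDF (addEdge adj u v) f → weight f ≡ k₊ → AllowedPair (f u) (f v)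
  allowed f trdf wf≡k₊ = minimum-endpoints-allowed adj u v γ k₊<k trdf wf≡k₊

  unit-endpoints : deg adj u ≡ 1 → deg adj v ≡ 1 →
    ∃[ f ] (IsTRDF (addEdge adj u v) f × weight f ≡ k₊ × f u ≡ 1 × f v ≡ 1)
  unit-endpoints deg-u≡1 deg-v≡1 with proj₁ γ₊ | noIsolated u | noIsolated v
  ... | f , trdf , wf≡k₊ | u′ , uu′ | v′ , vv′
    with allowed⇒unitEndpointsBelow simple u≢v uv∉G uu′ vv′
           (λ y → deg≡1⇒unique-neighbour adj deg-u≡1 uu′)
           (λ y → deg≡1⇒unique-neighbour adj deg-v≡1 vv′)
           trdf (allowed f trdf wf≡k₊)
  ...   | g , g-trdf , wg≤wf , gu≡1 , gv≡1 =
    g , g-trdf , ≤-antisym (subst (weight g ≤_) wf≡k₊ wg≤wf) (proj₂ γ₊ g g-trdf) , gu≡1 , gv≡1
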